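{- Let $M$ be a matroid on a finite linearly ordered ground set $(E,<)$ with set of bases $\mathcal{B}$. If a total order on $\mathcal{B}$ induces (via $B\mapsto F(B)$) a shelling of the external activity complex $\mathrm{Act}_<(M)$, then it also induces (via $B\mapsto B$) a shelling of the independence complex $IN(M)$.
   Context: For a basis $B$ and $e\in E-B$, $\mathrm{Circ}(B,e)$ is the unique circuit in $B\cup e$; $EA(B)=\{e\in E-B: e=\min_<\mathrm{Circ}(B,e)\}$, $EP(B)=(E-B)-EA(B)$. With $\overline{E}$ a disjoint copy of $E$ and $\overline{S}$ the copy of $S\subseteq E$, $\mathrm{Act}_<(M)$ is the simplicial complex on $E\sqcup\overline{E}$ with facets $F(B)=B\cup EP(B)\cup\overline{B\cup EA(B)}$. $IN(M)$ is the complex of independent sets of $M$, whose facets are the bases. A shelling order of a pure complex is an ordering $F_1,\dots,F_k$ of its facets such that for all $i<j$ there exist $l<j$ and $f\in F_j$ with $F_i\cap F_j\subseteq F_l\cap F_j=F_j-\{f\}$. -}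

module Defs where

open import Level using (0ℓ)
open import Data.Nat using (ℕ)
open import Data.Fin using (Fin; _≤_; _<_)
open import Data.Fin.Subset as S using (Subset; _∈_; _∉_; _⊆_; _⊂_; _∪_; _-_; ⁅_⁆)
open import Data.Sum using (_⊎_; inj₁; inj₂)
open import Data.Product using (_×_; Σ; ∃; ∃-syntax; _,_)
open import Data.List using (List; length; lookup; map)
open import Relation.Nullary using (¬_)
open import Relation.Unary as U using (Pred)
open import Relation.Binary.PropositionalEquality using (_≢_)

-- Matroids on the ground set E = Fin n, linearly ordered by the usual
-- order of Fin n, given by their bases (basis axioms).

record Matroid (n : ℕ) : Set₁ where
  field
    IsBasis  : Subset n → Set
    nonempty : ∃[ B ] IsBasis B
    exchange : ∀ {B₁ B₂} → IsBasis B₁ → IsBasis B₂ → ∀ {x} → x ∈ B₁ → x ∉ B₂ →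
               ∃[ y ] (y ∈ B₂ × y ∉ B₁ × IsBasis ((B₁ - x) ∪ ⁅ y ⁆))

module _ {n : ℕ} (M : Matroid n) where
  open Matroid M

  Independent : Subset n → Set
  Independent I = ∃[ B ] (IsBasis B × I ⊆ B)

  Dependent : Subset n → Set
  Dependent C = ¬ Independent C

  IsCircuit : Subset n → Set
  IsCircuit C = Dependent C × (∀ D → D ⊂ C → Independent D)

  -- Circ(B,e) is the unique circuit contained in B ∪ {e}.
  IsCirc : Subset n → Fin n → Subset n → Set
  IsCirc B e C = IsCircuit C × C ⊆ (B ∪ ⁅ e ⁆)

  EA : Subset n → Pred (Fin n) 0ℓ
  EA B e = e ∉ B × ∃[ C ] (IsCirc B e C × e ∈ C × (∀ x → x ∈ C → e ≤ x))

  EP : Subset n → Pred (Fin n) 0ℓ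
  EP B e = e ∉ B × ¬ EA B e

  -- Facet F(B) = B ∪ EP(B) ∪ overline(B ∪ EA(B)) of Act_<(M),
  -- as a subset of E ⊔ Ē = Fin n ⊎ Fin n (inj₂ = barred copy).
  ActFacet : Subset n → Pred (Fin n ⊎ Fin n) 0ℓ
  ActFacet B (inj₁ e) = e ∈ B ⊎ EP B e
  ActFacet B (inj₂ e) = e ∈ B ⊎ EA B e

toPred : ∀ {n} → Subset n → Pred (Fin n) 0ℓ
toPred B x = x ∈ B

_∖⁅_⁆ : ∀ {X : Set} → Pred X 0ℓ → X → Pred X 0ℓ
(F ∖⁅ f ⁆) x = F x × x ≢ f

IsShelling : ∀ {X : Set} → List (Pred X 0ℓ) → Set
IsShelling {X} Fs =
  ∀ (i j : Fin (length Fs)) → i < j →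
    ∃[ l ] (l < j × ∃[ f ] (f U.∈ lookup Fs j ×
      ((lookup Fs i U.∩ lookup Fs j) U.⊆ (lookup Fs l U.∩ lookup Fs j)) ×
      ((lookup Fs l U.∩ lookup Fs j) U.≐ (lookup Fs j ∖⁅ f ⁆))))

-- A basis B is recovered from its facet F(B) as the set of e whose two copies e, ē both lie
-- in F(B): for e ∉ B exactly one of them does, as EA(B) and EP(B) partition E - B.
-- Hence F(Bᵢ) ∩ F(Bⱼ) ⊆ F(Bₗ) ∩ F(Bⱼ) restricts to Bᵢ ∩ Bⱼ ⊆ Bₗ ∩ Bⱼ. If moreover
-- F(Bₗ) ∩ F(Bⱼ) = F(Bⱼ) - {f}, the removed vertex f must be a copy of some e ∈ Bⱼ, for
-- otherwise Bⱼ ⊆ Bₗ, impossible for distinct bases; and then Bₗ ∩ Bⱼ = Bⱼ - {e}.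
module Submission where

open import Defs
open import Data.Nat using (ℕ)
open import Data.Fin.Subset using (Subset)
open import Data.List using (List; map)
open import Data.List.Membership.Propositional using (_∈_)
open import Data.List.Relation.Unary.All using (All)
open import Data.List.Relation.Unary.Unique.Propositional using (Unique)

import Data.Nat as ℕ
open import Data.Fin using (Fin; zero; suc; toℕ; cast; _<_)
open import Data.Fin.Properties using (toℕ-cast; cast-involutive)
open import Data.Fin.Subset as S using (_⊆_)
open import Data.Fin.Subset.Properties using (⊆-antisym; _∈?_)
open import Data.List using (_∷_; length; lookup)
open import Data.List.Properties using (length-map)
open import Data.List.Membership.Propositional.Properties using (∈-lookup)
import Data.List.Relation.Unary.All as All
open import Data.List.Relation.Unary.AllPairs using (_∷_)
open import Data.Sum using (inj₁; inj₂; reduce)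
open import Data.Product using (_×_; ∃-syntax; _,_; proj₁; proj₂)
open import Data.Empty using (⊥-elim)
open import Function using (_∘_)
open import Level using (0ℓ)
open import Relation.Nullary.Decidable using (decidable-stable)
open import Relation.Unary as U using (Pred)
open import Relation.Binary.PropositionalEquality
  using (_≡_; _≢_; refl; sym; cong; subst; subst₂)

Shells : ∀ {X : Set} → Pred X 0ℓ → Pred X 0ℓ → Pred X 0ℓ → Set
Shells Fᵢ Fⱼ Fₗ = ∃[ f ] (f U.∈ Fⱼ × ((Fᵢ U.∩ Fⱼ) U.⊆ (Fₗ U.∩ Fⱼ)) × ((Fₗ U.∩ Fⱼ) U.≐ (Fⱼ ∖⁅ f ⁆)))

IsShellingOf : ∀ {C X : Set} → (C → Pred X 0ℓ) → List C → Set
IsShellingOf F bs = ∀ (i j : Fin (length bs)) → i < j →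
  ∃[ l ] (l < j × Shells (F (lookup bs i)) (F (lookup bs j)) (F (lookup bs l)))

module _ {a b} {A : Set a} {B : Set b} (f : A → B) where

  lookup-map : ∀ xs (i : Fin (length xs)) →
               lookup (map f xs) (cast (sym (length-map f xs)) i) ≡ f (lookup xs i)
  lookup-map (x ∷ xs) zero    = refl
  lookup-map (x ∷ xs) (suc i) = lookup-map xs i

cast-< : ∀ {m n} .(eq : m ≡ n) {i j : Fin m} → i < j → cast eq i < cast eq j
cast-< eq {i} {j} = subst₂ ℕ._<_ (sym (toℕ-cast eq i)) (sym (toℕ-cast eq j))

Unique-lookup-<⇒≢ : ∀ {A : Set} {xs : List A} → Unique xs →
                    ∀ {i j : Fin (length xs)} → i < j → lookup xs i ≢ lookup xs j
Unique-lookup-<⇒≢ (x∉xs ∷ _)   {zero}  {suc j} _           = All.lookup x∉xs (∈-lookup j)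
Unique-lookup-<⇒≢ (_    ∷ uxs) {suc i} {suc j} (ℕ.s≤s i<j) = Unique-lookup-<⇒≢ uxs i<j

module _ {C X : Set} (F : C → Pred X 0ℓ) (bs : List C) where

  private
    ι : Fin (length bs) → Fin (length (map F bs))
    ι = cast (sym (length-map F bs))

    κ : Fin (length (map F bs)) → Fin (length bs)
    κ = cast (length-map F bs)

    ι∘κ : ∀ k → ι (κ k) ≡ k
    ι∘κ = cast-involutive (sym (length-map F bs)) (length-map F bs)

    lookup-map-κ : ∀ k → lookup (map F bs) k ≡ F (lookup bs (κ k))
    lookup-map-κ k rewrite sym (lookup-map F bs (κ k)) | ι∘κ k = refl

  IsShelling-map⁻ : IsShelling (map F bs) → IsShellingOf F bs
  IsShelling-map⁻ shelling i j i<j with shelling (ι i) (ι j) (cast-< _ i<j)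
  ... | l , l<ιj , shells
    rewrite lookup-map F bs i | lookup-map F bs j | lookup-map-κ l =
      κ l , subst₂ ℕ._<_ (sym (toℕ-cast _ l)) (toℕ-cast _ j) l<ιj , shells

  IsShelling-map⁺ : IsShellingOf F bs → IsShelling (map F bs)
  IsShelling-map⁺ shelling i j i<j with shelling (κ i) (κ j) (cast-< _ i<j)
  ... | l , l<κj , shells
    rewrite lookup-map-κ i | lookup-map-κ j =
      ι l , subst₂ ℕ._<_ (sym (toℕ-cast _ l)) (toℕ-cast _ j) l<κj ,
      subst (Shells _ _) (sym (lookup-map F bs l)) shells

module _ {n : ℕ} (M : Matroid n) where
  open Matroid M

  basis-⊆⇒≡ : ∀ {B₁ B₂} → IsBasis B₁ → IsBasis B₂ → B₁ ⊆ B₂ → B₁ ≡ B₂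
  basis-⊆⇒≡ {B₁} {B₂} b₁ b₂ B₁⊆B₂ = ⊆-antisym B₁⊆B₂ B₂⊆B₁
    where
    B₂⊆B₁ : B₂ ⊆ B₁
    B₂⊆B₁ {x} x∈B₂ = decidable-stable (x ∈? B₁) λ x∉B₁ →
      let y , y∈B₁ , y∉B₂ , _ = exchange b₂ b₁ x∈B₂ x∉B₁ in y∉B₂ (B₁⊆B₂ y∈B₁)

  ∈⇒ActFacet : ∀ {B} c → reduce c S.∈ B → ActFacet M B c
  ∈⇒ActFacet (inj₁ x) x∈B = inj₁ x∈B
  ∈⇒ActFacet (inj₂ x) x∈B = inj₁ x∈B

  ActFacet-copies⇒∈ : ∀ {B x} → ActFacet M B (inj₁ x) → ActFacet M B (inj₂ x) → x S.∈ B
  ActFacet-copies⇒∈ (inj₁ x∈B)        _           = x∈B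
  ActFacet-copies⇒∈ (inj₂ _)          (inj₁ x∈B)  = x∈B
  ActFacet-copies⇒∈ (inj₂ (_ , x∉EA)) (inj₂ x∈EA) = ⊥-elim (x∉EA x∈EA)

  Shells-ActFacet⇒Shells : ∀ {Bᵢ Bⱼ Bₗ} → IsBasis Bⱼ → IsBasis Bₗ → Bₗ ≢ Bⱼ →
    Shells (ActFacet M Bᵢ) (ActFacet M Bⱼ) (ActFacet M Bₗ) →
    Shells (toPred Bᵢ) (toPred Bⱼ) (toPred Bₗ)
  Shells-ActFacet⇒Shells {Bᵢ} {Bⱼ} {Bₗ} bⱼ bₗ Bₗ≢Bⱼ (f , _ , Fᵢⱼ⊆Fₗⱼ , Fₗⱼ⊆Fⱼ-f , Fⱼ-f⊆Fₗⱼ) =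
    e , e∈Bⱼ , Bᵢⱼ⊆Bₗⱼ , (Bₗⱼ⊆Bⱼ-e , Bⱼ-e⊆Bₗⱼ)
    where
    e : Fin n
    e = reduce f

    Bᵢⱼ⊆Bₗⱼ : (toPred Bᵢ U.∩ toPred Bⱼ) U.⊆ (toPred Bₗ U.∩ toPred Bⱼ)
    Bᵢⱼ⊆Bₗⱼ {x} (x∈Bᵢ , x∈Bⱼ) =
      ActFacet-copies⇒∈ {Bₗ} (proj₁ (Fᵢⱼ⊆Fₗⱼ {inj₁ x} (inj₁ x∈Bᵢ , inj₁ x∈Bⱼ)))
                        (proj₁ (Fᵢⱼ⊆Fₗⱼ {inj₂ x} (inj₁ x∈Bᵢ , inj₁ x∈Bⱼ))) , x∈Bⱼ

    Bⱼ-e⊆Bₗ : ∀ {x} → x S.∈ Bⱼ → x ≢ e → x S.∈ Bₗ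
    Bⱼ-e⊆Bₗ {x} x∈Bⱼ x≢e =
      ActFacet-copies⇒∈ {Bₗ} (proj₁ (Fⱼ-f⊆Fₗⱼ {inj₁ x} (inj₁ x∈Bⱼ , x≢e ∘ cong reduce)))
                        (proj₁ (Fⱼ-f⊆Fₗⱼ {inj₂ x} (inj₁ x∈Bⱼ , x≢e ∘ cong reduce)))

    e∈Bⱼ : e S.∈ Bⱼ
    e∈Bⱼ = decidable-stable (e ∈? Bⱼ) λ e∉Bⱼ →
      Bₗ≢Bⱼ (sym (basis-⊆⇒≡ bⱼ bₗ λ x∈Bⱼ → Bⱼ-e⊆Bₗ x∈Bⱼ λ { refl → e∉Bⱼ x∈Bⱼ }))

    Bₗⱼ⊆Bⱼ-e : (toPred Bₗ U.∩ toPred Bⱼ) U.⊆ (toPred Bⱼ ∖⁅ e ⁆)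
    Bₗⱼ⊆Bⱼ-e (x∈Bₗ , x∈Bⱼ) =
      x∈Bⱼ , λ { refl → proj₂ (Fₗⱼ⊆Fⱼ-f (∈⇒ActFacet f x∈Bₗ , ∈⇒ActFacet f x∈Bⱼ)) refl }

    Bⱼ-e⊆Bₗⱼ : (toPred Bⱼ ∖⁅ e ⁆) U.⊆ (toPred Bₗ U.∩ toPred Bⱼ)
    Bⱼ-e⊆Bₗⱼ (x∈Bⱼ , x≢e) = Bⱼ-e⊆Bₗ x∈Bⱼ x≢e , x∈Bⱼ

corollary4p3 : ∀ (n : ℕ) (M : Matroid n) (bs : List (Subset n)) →
    Unique bs → All (Matroid.IsBasis M) bs → (∀ B → Matroid.IsBasis M B → B ∈ bs) →
    IsShelling (map (ActFacet M) bs) → IsShelling (map toPred bs)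
corollary4p3 n M bs unique bases _ actShelling =
  IsShelling-map⁺ toPred bs λ i j i<j →
    let l , l<j , shells = IsShelling-map⁻ (ActFacet M) bs actShelling i j i<j
    in l , l<j , Shells-ActFacet⇒Shells M (basis j) (basis l) (Unique-lookup-<⇒≢ unique l<j) shells
  where
  basis : ∀ k → Matroid.IsBasis M (lookup bs k)
  basis k = All.lookup bases (∈-lookup k)
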